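{- Let $p,q$ be positive integers with $p<q$, and let $s'$ be a nonnegative integer. Let $G$ be a graph with an independent set $M=\{m_{ij}: 1 \leq i \leq p,\ 1 \leq j \leq q\}$ of size $pq$. Let $\phi$ be a proper $(s'+q)$-coloring of $G$ with colors $\{1,\dots,s'+q\}$ satisfying: (i) all $s'$ colors $1,\dots,s'$ are assigned to vertices of $V(G)\setminus M$; (ii) for every vertex $x$ of $G$, $s'+1 \leq \phi(x) \leq s'+ q$ if and only if $x \in M$; (iii) any two distinct vertices $x,y$ of $G$ are neighbor-distinguished with respect to $\phi$ unless both belong to $M$; (iv) $\phi(m_{ij}) = s'+j$ for all $1 \leq i \leq p$, $1 \leq j \leq q$. Then there is a spanning supergraph $G'$ of $G$, obtained from $G$ by adding the edges of a matching between vertices of $M$, such that $\phi$ is a neighbor-locating $(s'+q)$-coloring of $G'$.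
   Context: All graphs are finite and simple. For a proper coloring $f$ of a graph and a vertex $x$, let $N_f(x)=\{f(y): y \text{ adjacent to } x\}$. Two vertices $x,y$ are neighbor-distinguished with respect to $f$ if $f(x)\neq f(y)$ or $N_f(x)\neq N_f(y)$. A proper $k$-coloring is a neighbor-locating $k$-coloring if every two distinct vertices are neighbor-distinguished. -}

module Defs where

open import Level using (0ℓ)
open import Data.Nat using (ℕ; _+_; _<_; _≤_)
open import Data.Fin using (Fin; toℕ)
open import Data.Product using (Σ; ∃; ∃-syntax; _×_; _,_)
open import Data.Sum using (_⊎_)
open import Relation.Nullary using (¬_)
open import Relation.Binary.PropositionalEquality using (_≡_; _≢_)
open import Function.Bundles using (_⇔_)

record Graph (n : ℕ) : Set₁ where
  field
    Adj    : Fin n → Fin n → Set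
    sym    : ∀ {x y} → Adj x y → Adj y x
    irrefl : ∀ {x} → ¬ Adj x x
open Graph public

module _ {n : ℕ} (G : Graph n) where

  -- f is a proper coloring with k colors (colors are Fin k; color c ↔ c+1 in the paper)
  Proper : {k : ℕ} → (Fin n → Fin k) → Set
  Proper f = ∀ {x y} → Adj G x y → f x ≢ f y

  NbrColor : {k : ℕ} → (Fin n → Fin k) → Fin n → Fin k → Set
  NbrColor f x c = ∃[ y ] (Adj G x y × f y ≡ c)

  SameNbrColors : {k : ℕ} → (Fin n → Fin k) → Fin n → Fin n → Set
  SameNbrColors f x y = ∀ c → (NbrColor f x c ⇔ NbrColor f y c)

  NeighborDistinguished : {k : ℕ} → (Fin n → Fin k) → Fin n → Fin n → Set
  NeighborDistinguished f x y = f x ≢ f y ⊎ ¬ SameNbrColors f x y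

  NeighborLocating : {k : ℕ} → (Fin n → Fin k) → Set
  NeighborLocating f =
    Proper f × (∀ x y → x ≢ y → NeighborDistinguished f x y)

record MatchingIn {n : ℕ} (S : Fin n → Set) : Set₁ where
  field
    E       : Fin n → Fin n → Set
    sym     : ∀ {x y} → E x y → E y x
    irrefl  : ∀ {x} → ¬ E x x
    unique  : ∀ {x y z} → E x y → E x z → y ≡ z
    inside  : ∀ {x y} → E x y → S x × S y
open MatchingIn public

addMatching : ∀ {n} {S : Fin n → Set} → Graph n → MatchingIn S → Graph n
addMatching G μ = record
  { Adj    = λ x y → Adj G x y ⊎ E μ x y
  ; sym    = λ { (Data.Sum.inj₁ a) → Data.Sum.inj₁ (Graph.sym G a)
               ; (Data.Sum.inj₂ b) → Data.Sum.inj₂ (MatchingIn.sym μ b) }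
  ; irrefl = λ { (Data.Sum.inj₁ a) → Graph.irrefl G a
               ; (Data.Sum.inj₂ b) → MatchingIn.irrefl μ b }
  }

InM : ∀ {n p q} → (Fin p → Fin q → Fin n) → Fin n → Set
InM m x = ∃[ i ] ∃[ j ] (m i j ≡ x)

{-# OPTIONS --safe #-}
-- Split M into its p rows {m i j : j < q} and, inside row i, match m i j with
-- m i k whenever j + k ≡ i (mod q); fixed points of this involution stay
-- unmatched.  Take m i j and m i′ j of equal colour s′ + j, so i ≠ i′.  If m i j
-- has a partner m i k, its colour s′ + k is a neighbour colour of m i j, and
-- m i′ j, whose other neighbours lie outside M, can only see that colour at its
-- own partner; then j + k ≡ i′ as well, so i ≡ i′.  If neither is matched, then
-- 2j ≡ i and 2j ≡ i′ (mod q), again forcing i ≡ i′ as both are below q.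
-- Vertices outside M keep their neighbourhoods.
module Submission where

open import Defs hiding (sym)
open import Data.Nat using (ℕ; _+_; _∸_; _%_; _<_; _≤_; _≤?_; NonZero; >-nonZero; z≤n)
open import Data.Nat.Properties
  using (+-comm; +-assoc; +-cancelˡ-≡; m+[n∸m]≡n; m∸n+n≡m; m≤m+n; ≤-<-trans; <-trans; <⇒≤)
open import Data.Nat.DivMod using (%-distribˡ-+; m%n%n≡m%n; [m+n]%n≡m%n; m<n⇒m%n≡m; m%n<n)
open import Data.Fin using (Fin; toℕ; fromℕ<)
open import Data.Fin.Properties using (toℕ-injective; toℕ-fromℕ<; toℕ<n) renaming (_≟_ to _≟ᶠ_)
open import Data.Product using (Σ; ∃-syntax; _×_; _,_; proj₁; proj₂)
open import Data.Sum using (_⊎_; inj₁; inj₂)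
open import Data.Empty using (⊥-elim)
open import Relation.Nullary using (¬_; Dec; yes; no)
open import Relation.Nullary.Decidable using (map)
open import Relation.Binary.PropositionalEquality
  using (_≡_; _≢_; refl; sym; trans; cong; subst; module ≡-Reasoning)
open import Function.Bundles using (_⇔_; mk⇔; Equivalence)
open import Function.Construct.Symmetry using (⇔-sym)

[m+n%d]%d≡[m+n]%d : ∀ m n d .{{_ : NonZero d}} → (m + n % d) % d ≡ (m + n) % d
[m+n%d]%d≡[m+n]%d m n d = begin
  (m + n % d) % d           ≡⟨ %-distribˡ-+ m (n % d) d ⟩
  (m % d + n % d % d) % d   ≡⟨ cong (λ t → (m % d + t) % d) (m%n%n≡m%n n d) ⟩
  (m % d + n % d) % d       ≡⟨ %-distribˡ-+ m n d ⟨
  (m + n) % d               ∎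
  where open ≡-Reasoning

m+n≡d⇒[m+[n+o]%d]%d≡o%d : ∀ {m n} o {d} .{{_ : NonZero d}} →
                          m + n ≡ d → (m + (n + o) % d) % d ≡ o % d
m+n≡d⇒[m+[n+o]%d]%d≡o%d {m} {n} o {d} m+n≡d = begin
  (m + (n + o) % d) % d   ≡⟨ [m+n%d]%d≡[m+n]%d m (n + o) d ⟩
  (m + (n + o)) % d       ≡⟨ cong (_% d) (sym (+-assoc m n o)) ⟩
  (m + n + o) % d         ≡⟨ cong (λ t → (t + o) % d) m+n≡d ⟩
  (d + o) % d             ≡⟨ cong (_% d) (+-comm d o) ⟩
  (o + d) % d             ≡⟨ [m+n]%n≡m%n o d ⟩
  o % d                   ∎
  where open ≡-Reasoning

[m+n]%d≡[m+o]%d⇒n≡o : ∀ {m n o d} .{{_ : NonZero d}} → m ≤ d → n < d → o < d →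
                      (m + n) % d ≡ (m + o) % d → n ≡ o
[m+n]%d≡[m+o]%d⇒n≡o {m} {n} {o} {d} m≤d n<d o<d eq = begin
  n                             ≡⟨ m<n⇒m%n≡m n<d ⟨
  n % d                         ≡⟨ m+n≡d⇒[m+[n+o]%d]%d≡o%d n (m∸n+n≡m m≤d) ⟨
  (d ∸ m + (m + n) % d) % d     ≡⟨ cong (λ t → (d ∸ m + t) % d) eq ⟩
  (d ∸ m + (m + o) % d) % d     ≡⟨ m+n≡d⇒[m+[n+o]%d]%d≡o%d o (m∸n+n≡m m≤d) ⟩
  o % d                         ≡⟨ m<n⇒m%n≡m o<d ⟩
  o                             ∎
  where open ≡-Reasoning

[m+[[d∸m]+n]%d]%d≡n : ∀ {m n d} .{{_ : NonZero d}} → m ≤ d → n < d →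
                      (m + (d ∸ m + n) % d) % d ≡ n
[m+[[d∸m]+n]%d]%d≡n {m} {n} m≤d n<d =
  trans (m+n≡d⇒[m+[n+o]%d]%d≡o%d n (m+[n∸m]≡n m≤d)) (m<n⇒m%n≡m n<d)

module _ {n k : ℕ} {S : Fin n → Set} (G : Graph n) (μ : MatchingIn S) (φ : Fin n → Fin k) where

  NbrColor-addMatching⁺ : ∀ {x c} → NbrColor G φ x c → NbrColor (addMatching G μ) φ x c
  NbrColor-addMatching⁺ (y , x~y , φy≡c) = y , inj₁ x~y , φy≡c

  NbrColor-addMatching⁻ : ∀ {x c} → ¬ S x → NbrColor (addMatching G μ) φ x c → NbrColor G φ x c
  NbrColor-addMatching⁻ x∉S (y , inj₁ x~y , φy≡c) = y , x~y , φy≡c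
  NbrColor-addMatching⁻ x∉S (y , inj₂ xy∈μ , _) = ⊥-elim (x∉S (proj₁ (MatchingIn.inside μ xy∈μ)))

  Proper-addMatching : Proper G φ → (∀ {x y} → E μ x y → φ x ≢ φ y) → Proper (addMatching G μ) φ
  Proper-addMatching proper _ (inj₁ x~y) = proper x~y
  Proper-addMatching _ μ-proper (inj₂ xy∈μ) = μ-proper xy∈μ

  NeighborDistinguished-addMatching : ∀ {x y} → ¬ S x → ¬ S y →
    NeighborDistinguished G φ x y → NeighborDistinguished (addMatching G μ) φ x y
  NeighborDistinguished-addMatching _ _ (inj₁ φx≢φy) = inj₁ φx≢φy
  NeighborDistinguished-addMatching x∉S y∉S (inj₂ ¬same) = inj₂ λ same′ → ¬same λ c → mk⇔
    (λ h → NbrColor-addMatching⁻ y∉S (Equivalence.to (same′ c) (NbrColor-addMatching⁺ h)))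
    (λ h → NbrColor-addMatching⁻ x∉S (Equivalence.from (same′ c) (NbrColor-addMatching⁺ h)))

module RowMatching (p q s′ n : ℕ) (p<q : p < q) (G : Graph n) (m : Fin p → Fin q → Fin n)
  (m-injective : ∀ i j i′ j′ → m i j ≡ m i′ j′ → i ≡ i′ × j ≡ j′)
  (M-independent : ∀ i j i′ j′ → ¬ Adj G (m i j) (m i′ j′))
  (φ : Fin n → Fin (s′ + q))
  (high⇔M : ∀ x → (s′ ≤ toℕ (φ x) ⇔ InM m x))
  (φ-m : ∀ i j → toℕ (φ (m i j)) ≡ s′ + toℕ j) where

  instance
    q-nonZero : NonZero q
    q-nonZero = >-nonZero (≤-<-trans z≤n p<q)

  -- A record rather than a definition, so that i, j and k can be inferred.
  record Complement (i : Fin p) (j k : Fin q) : Set where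
    constructor sums-to
    field sum%q≡ : (toℕ j + toℕ k) % q ≡ toℕ i

  complement-sym : ∀ {i j k} → Complement i j k → Complement i k j
  complement-sym {j = j} {k} (sums-to c) =
    sums-to (trans (cong (_% q) (+-comm (toℕ k) (toℕ j))) c)

  complement-unique : ∀ {i j k k′} → Complement i j k → Complement i j k′ → k ≡ k′
  complement-unique {j = j} {k} {k′} (sums-to c) (sums-to c′) = toℕ-injective
    ([m+n]%d≡[m+o]%d⇒n≡o (<⇒≤ (toℕ<n j)) (toℕ<n k) (toℕ<n k′) (trans c (sym c′)))

  complement-injective : ∀ {i i′ j k} → Complement i j k → Complement i′ j k → i ≡ i′
  complement-injective (sums-to c) (sums-to c′) = toℕ-injective (trans (sym c) c′)

  complement : (i : Fin p) (j : Fin q) → ∃[ k ] Complement i j k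
  complement i j = fromℕ< (m%n<n (q ∸ toℕ j + toℕ i) q) , sums-to (begin
    (toℕ j + toℕ (fromℕ< _)) % q          ≡⟨ cong (λ t → (toℕ j + t) % q) (toℕ-fromℕ< _) ⟩
    (toℕ j + (q ∸ toℕ j + toℕ i) % q) % q
      ≡⟨ [m+[[d∸m]+n]%d]%d≡n (<⇒≤ (toℕ<n j)) (<-trans (toℕ<n i) p<q) ⟩
    toℕ i                                 ∎)
    where open ≡-Reasoning

  Partners : Fin n → Fin n → Set
  Partners x y = ∃[ i ] ∃[ j ] ∃[ k ] (m i j ≡ x × m i k ≡ y × j ≢ k × Complement i j k)

  rowMatching : MatchingIn (InM m)
  rowMatching = record
    { E      = Partners
    ; sym    = λ (i , j , k , mij≡x , mik≡y , j≢k , c) →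
                 i , k , j , mik≡y , mij≡x , (λ k≡j → j≢k (sym k≡j)) , complement-sym c
    ; irrefl = λ (i , j , k , mij≡x , mik≡x , j≢k , _) →
                 j≢k (proj₂ (m-injective i j i k (trans mij≡x (sym mik≡x))))
    ; unique = partners-unique
    ; inside = λ (i , j , k , mij≡x , mik≡y , _) → (i , j , mij≡x) , (i , k , mik≡y)
    }
    where
    partners-unique : ∀ {x y z} → Partners x y → Partners x z → y ≡ z
    partners-unique (i , j , k , refl , refl , _ , c) (i′ , j′ , k′ , mi′j′≡mij , refl , _ , c′)
      with refl , refl ← m-injective i′ j′ i j mi′j′≡mij
      = cong (m i) (complement-unique c c′)

  G′ : Graph n
  G′ = addMatching G rowMatching

  colour-injective : ∀ {i i′ j j′} → φ (m i j) ≡ φ (m i′ j′) → j ≡ j′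
  colour-injective {i} {i′} {j} {j′} e = toℕ-injective
    (+-cancelˡ-≡ s′ _ _ (trans (sym (φ-m i j)) (trans (cong toℕ e) (φ-m i′ j′))))

  partners-proper : ∀ {x y} → Partners x y → φ x ≢ φ y
  partners-proper (i , j , k , refl , refl , j≢k , _) e = j≢k (colour-injective e)

  M-high : ∀ i j → s′ ≤ toℕ (φ (m i j))
  M-high i j = subst (s′ ≤_) (sym (φ-m i j)) (m≤m+n s′ (toℕ j))

  partner-colour⇒complement : ∀ {i i′ j k} →
    NbrColor G′ φ (m i j) (φ (m i′ k)) → Complement i j k
  partner-colour⇒complement {i} {i′} {j} {k} (z , inj₁ mij~z , φz≡c)
    with i″ , j″ , refl ← Equivalence.to (high⇔M z)
                            (subst (λ c → s′ ≤ toℕ c) (sym φz≡c) (M-high i′ k))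
    = ⊥-elim (M-independent i j i″ j″ mij~z)
  partner-colour⇒complement {i} {i′} {j} {k}
    (_ , inj₂ (i″ , j″ , k″ , mi″j″≡mij , refl , _ , c) , φz≡c)
    with refl , refl ← m-injective i″ j″ i j mi″j″≡mij
    with refl ← colour-injective {i} {i′} {k″} {k} φz≡c
    = c

  complement⇒partner-colour : ∀ {i j k} → Complement i j k → j ≢ k →
    NbrColor G′ φ (m i j) (φ (m i k))
  complement⇒partner-colour {i} {j} {k} c j≢k =
    m i k , inj₂ (i , j , k , refl , refl , j≢k , c) , refl

  complement-transfer : ∀ {i i′ j k} → SameNbrColors G′ φ (m i j) (m i′ j) →
    Complement i j k → j ≢ k → Complement i′ j k
  complement-transfer {i} {k = k} same c j≢k = partner-colour⇒complement
    (Equivalence.to (same (φ (m i k))) (complement⇒partner-colour c j≢k))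

  rows-distinguished : ∀ {i i′ j} → i ≢ i′ → ¬ SameNbrColors G′ φ (m i j) (m i′ j)
  rows-distinguished {i} {i′} {j} i≢i′ same
    with complement i j | complement i′ j
  ... | k , c | k′ , c′ with j ≟ᶠ k | j ≟ᶠ k′
  ... | no j≢k | _ = i≢i′ (complement-injective c (complement-transfer same c j≢k))
  ... | yes _ | no j≢k′ =
    i≢i′ (complement-injective (complement-transfer (λ c → ⇔-sym (same c)) c′ j≢k′) c′)
  ... | yes refl | yes refl = i≢i′ (complement-injective c c′)

  M-distinguished : ∀ {i i′ j j′} → m i j ≢ m i′ j′ → NeighborDistinguished G′ φ (m i j) (m i′ j′)
  M-distinguished {i} {i′} {j} {j′} mij≢mi′j′ with j ≟ᶠ j′
  ... | no j≢j′ = inj₁ (λ e → j≢j′ (colour-injective e))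
  ... | yes refl = inj₂ (rows-distinguished λ { refl → mij≢mi′j′ refl })

  InM? : ∀ x → Dec (InM m x)
  InM? x = map (high⇔M x) (s′ ≤? toℕ (φ x))

  colour-separates-M : ∀ {x y} → InM m x → ¬ InM m y → φ x ≢ φ y
  colour-separates-M {x} {y} x∈M y∉M φx≡φy = y∉M (Equivalence.to (high⇔M y)
    (subst (λ c → s′ ≤ toℕ c) φx≡φy (Equivalence.from (high⇔M x) x∈M)))

  neighborLocating : Proper G φ →
    (∀ x y → x ≢ y → ¬ (InM m x × InM m y) → NeighborDistinguished G φ x y) →
    NeighborLocating G′ φ
  neighborLocating proper distinguished =
    Proper-addMatching G rowMatching φ proper partners-proper , distinguished′
    where
    distinguished′ : ∀ x y → x ≢ y → NeighborDistinguished G′ φ x y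
    distinguished′ x y x≢y with InM? x | InM? y
    ... | yes (_ , _ , refl) | yes (_ , _ , refl) = M-distinguished x≢y
    ... | yes x∈M | no y∉M = inj₁ (colour-separates-M x∈M y∉M)
    ... | no x∉M | yes y∈M = inj₁ (λ φx≡φy → colour-separates-M y∈M x∉M (sym φx≡φy))
    ... | no x∉M | no y∉M = NeighborDistinguished-addMatching G rowMatching φ x∉M y∉M
                               (distinguished x y x≢y (λ (x∈M , _) → x∉M x∈M))

corollary1 : (p q s′ n : ℕ) → 0 < p → p < q →
    (G : Graph n) →
    (m : Fin p → Fin q → Fin n) →
    (∀ i j i′ j′ → m i j ≡ m i′ j′ → (i ≡ i′ × j ≡ j′)) →
    (∀ i j i′ j′ → ¬ Adj G (m i j) (m i′ j′)) →
    (φ : Fin n → Fin (s′ + q)) →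
    Proper G φ →
    (∀ (c : Fin (s′ + q)) → toℕ c < s′ → ∃[ x ] (¬ InM m x × φ x ≡ c)) →
    (∀ x → (s′ ≤ toℕ (φ x) ⇔ InM m x)) →
    (∀ x y → x ≢ y → ¬ (InM m x × InM m y) → NeighborDistinguished G φ x y) →
    (∀ i j → toℕ (φ (m i j)) ≡ s′ + toℕ j) →
    Σ (MatchingIn (InM m)) λ μ → NeighborLocating (addMatching G μ) φ
corollary1 p q s′ n _ p<q G m m-injective M-independent φ proper _ high⇔M distinguished φ-m =
  R.rowMatching , R.neighborLocating proper distinguished
  where module R = RowMatching p q s′ n p<q G m m-injective M-independent φ high⇔M φ-m
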